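{- For every pair of positive odd integers $m$ and $n$ with $m+n\ge 4$, there exists a $3$-connected equimatchable factor-critical graph $G$ with independence number $3$ and a vertex cut $S$ of size $3$ such that $G-S$ has two components, with $m$ and $n$ vertices respectively.
   Context: All graphs are finite, simple and undirected. A graph is equimatchable if every maximal matching is a maximum matching. A graph is factor-critical if $G-v$ has a perfect matching for every vertex $v$. The independence number is the maximum size of an independent set of vertices. -}

module Defs where

open import Data.Nat using (ℕ; suc; _+_; _*_; _≤_; _<_)
open import Data.Bool using (Bool; true; false)
open import Data.Fin using (Fin)
open import Data.Fin.Subset using (Subset; _∈_; _∉_; ∁; ∣_∣)
open import Data.List using (List; []; _∷_; length; concatMap)
open import Data.List.Relation.Unary.All using (All)
open import Data.List.Relation.Unary.Unique.Propositional using (Unique)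
import Data.List.Membership.Propositional as LM
open import Data.Product using (Σ; ∃; _×_; _,_)
open import Relation.Binary.PropositionalEquality using (_≡_)
open import Relation.Nullary using (¬_)

Odd : ℕ → Set
Odd m = ∃ λ k → m ≡ suc (2 * k)

record Graph (v : ℕ) : Set where
  field
    adj   : Fin v → Fin v → Bool
    sym   : ∀ x y → adj x y ≡ adj y x
    irrefl : ∀ x → adj x x ≡ false
open Graph public

module _ {v : ℕ} (G : Graph v) where

  Edge : Fin v → Fin v → Set
  Edge x y = adj G x y ≡ true

  endpoints : List (Fin v × Fin v) → List (Fin v)
  endpoints = concatMap (λ { (a , b) → a ∷ b ∷ [] })

  IsMatching : List (Fin v × Fin v) → Set
  IsMatching M = All (λ { (a , b) → Edge a b }) M × Unique (endpoints M)

  size : List (Fin v × Fin v) → ℕ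
  size = length

  Covered : Fin v → List (Fin v × Fin v) → Set
  Covered x M = x LM.∈ endpoints M

  IsMaximal : List (Fin v × Fin v) → Set
  IsMaximal M = IsMatching M ×
    (∀ x y → Edge x y → ¬ Covered x M → ¬ Covered y M → Data.Empty.⊥)
    where import Data.Empty

  IsMaximum : List (Fin v × Fin v) → Set
  IsMaximum M = IsMatching M × (∀ M′ → IsMatching M′ → size M′ ≤ size M)

  Equimatchable : Set
  Equimatchable = ∀ M → IsMaximal M → IsMaximum M

  -- G - x has a perfect matching: a matching of G (equivalently of the
  -- induced subgraph G - x) avoiding x and covering every other vertex.
  FactorCritical : Set
  FactorCritical = ∀ x → ∃ λ M → IsMatching M × ¬ Covered x M ×
    (∀ y → ¬ y ≡ x → Covered y M)

  Independent : Subset v → Set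
  Independent X = ∀ x y → x ∈ X → y ∈ X → ¬ Edge x y

  IndependenceNumber : ℕ → Set
  IndependenceNumber k =
    (∃ λ X → Independent X × ∣ X ∣ ≡ k) ×
    (∀ X → Independent X → ∣ X ∣ ≤ k)

  data WalkIn (X : Subset v) : Fin v → Fin v → Set where
    here : ∀ {x} → x ∈ X → WalkIn X x x
    step : ∀ {x y z} → x ∈ X → Edge x y → WalkIn X y z → WalkIn X x z

  ConnectedIn : Subset v → Set
  ConnectedIn X = (∃ λ x → x ∈ X) × (∀ x y → x ∈ X → y ∈ X → WalkIn X x y)

  KConnected : ℕ → Set
  KConnected k = k < v × (∀ X → ∣ X ∣ < k → ConnectedIn (∁ X))

  -- S is a vertex cut such that G - S has exactly two components, with
  -- vertex sets A and B: V is the disjoint union of S, A, B; G[A] and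
  -- G[B] are connected; and there is no edge between A and B.
  TwoComponentsAfter : Subset v → Subset v → Subset v → Set
  TwoComponentsAfter S A B =
    (∀ x → (x ∈ S × x ∉ A × x ∉ B) Data.Sum.⊎
           ((x ∉ S × x ∈ A × x ∉ B) Data.Sum.⊎ (x ∉ S × x ∉ A × x ∈ B))) ×
    ConnectedIn A × ConnectedIn B ×
    (∀ x y → x ∈ A → y ∈ B → ¬ Edge x y)
    where import Data.Sum

-- The graph is the join of an independent set S = {s₀, s₁, s₂} with the disjoint union of the cliques
-- K_m and K_n. Every vertex outside S is adjacent to all of S, so after deleting at most two vertices a
-- surviving vertex of S reaches everything; and three pairwise non-adjacent vertices must all lie in S,
-- which gives independence number 3. Deleting a vertex leaves an even number of vertices, which are
-- perfectly matched by joining the vertices of S to the odd clique(s) and pairing off the rest inside the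
-- cliques. A maximal matching leaves an independent set uncovered, of odd size since the order is odd; if
-- it had three vertices it would be S itself, so the matching would restrict to a perfect matching of the
-- odd clique K_m, which is impossible. Hence every maximal matching misses exactly one vertex.
module Submission where

open import Defs
open import Data.Nat using (ℕ; _+_; _≤_; _<_)
open import Data.Fin.Subset using (Subset; ∣_∣)
open import Data.Product using (Σ; ∃; _×_)
open import Relation.Binary.PropositionalEquality using (_≡_)

open import Data.Bool using (Bool; true; false; if_then_else_)
open import Data.Bool.Properties using (¬-not)
open import Data.Empty using (⊥; ⊥-elim)
open import Data.Fin using (Fin; zero; suc; _↑ˡ_; _↑ʳ_; splitAt)
import Data.Fin.Properties as Finₚ
open import Data.Fin.Subset using (_∈_; _∉_; ∁; inside; outside)
open import Data.Fin.Subset.Properties using (_∈?_; x∉p⇒x∈∁p)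
open import Data.List using (List; []; _∷_; _++_; length; map; filter; allFin)
open import Data.List.Properties
  using (filter-accept; filter-reject; length-++; length-map; length-tabulate; length-removeAt′)
import Data.List.Membership.DecPropositional as DecMembership
open import Data.List.Membership.Propositional using (find; _─_) renaming (_∈_ to _∈ˡ_)
open import Data.List.Membership.Propositional.Properties
  using (∈-map⁺; ∈-map⁻; ∈-allFin; ∈-filter⁺; ∈-filter⁻; ∈-++⁺ˡ; ∈-++⁺ʳ; ∈-∃++)
open import Data.List.Relation.Binary.Disjoint.Propositional using (Disjoint)
open import Data.List.Relation.Binary.Permutation.Propositional
  using (_↭_; ↭-refl; ↭-sym; ↭-trans; ↭-prep; ↭⇒↭ₛ; module PermutationReasoning)
open import Data.List.Relation.Binary.Permutation.Propositional.Properties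
  using (shift; ++⁺ˡ; ++⁺ʳ; ++-comm; ++-identityʳ; ↭-length; ∈-resp-↭; All-resp-↭)
import Data.List.Relation.Binary.Permutation.Setoid.Properties as Permₛ
open import Data.List.Relation.Unary.Any using (here; there; index)
open import Data.List.Relation.Unary.All as All using (All; []; _∷_)
open import Data.List.Relation.Unary.All.Properties using (all-filter; ++⁺) renaming (map⁺ to All-map⁺)
open import Data.List.Relation.Unary.All.Properties.Core using (¬All⇒Any¬)
open import Data.List.Relation.Unary.AllPairs using (AllPairs; []; _∷_)
open import Data.List.Relation.Unary.Unique.Propositional using (Unique)
import Data.List.Relation.Unary.Unique.Propositional.Properties as Uniqueₚ
open import Data.Nat using (zero; suc; _*_; z≤n; s≤s; s≤s⁻¹)
open import Data.Nat.Properties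
  using (≤-trans; ≤-reflexive; ≤-antisym; m≤n⇒m≤1+n; n≤1+n; _≤?_; ≰⇒>; ≮⇒≥; <⇒≱; <-irrefl;
         suc-injective; +-suc; module ≤-Reasoning; +-comm; +-monoʳ-≤; *-monoʳ-≤; *-suc; even≢odd)
open import Data.Nat.Tactic.RingSolver using (solve-∀)
open import Data.Product using (_,_; proj₁; proj₂)
open import Data.Sum using (_⊎_; inj₁; inj₂; [_,_]′)
open import Data.Vec using (tabulate; []; _∷_; here; there)
open import Data.Vec.Properties using (lookup∘tabulate; lookup⇒[]=; []=⇒lookup)
open import Function using (_∘_; const; id)
open import Relation.Binary.Definitions using (DecidableEquality)
open import Relation.Binary.PropositionalEquality as ≡ using (_≢_; refl; trans; cong; subst; subst₂)
open import Relation.Nullary using (¬_; yes; no; does; contradiction; ¬?)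
open import Relation.Nullary.Decidable using (dec-true)
open import Relation.Unary using (Decidable)

module _ {A : Set} where

  ∈-─⁺ : ∀ {x y} {ys : List A} (x∈ys : x ∈ˡ ys) → y ∈ˡ ys → y ≢ x → y ∈ˡ ys ─ x∈ys
  ∈-─⁺ (here refl) (here refl) y≢x = ⊥-elim (y≢x refl)
  ∈-─⁺ (here refl) (there y∈ys) _ = y∈ys
  ∈-─⁺ (there _) (here refl) _ = here refl
  ∈-─⁺ (there x∈ys) (there y∈ys) y≢x = there (∈-─⁺ x∈ys y∈ys y≢x)

  unique-⊆⇒length≤ : ∀ {xs ys : List A} → Unique xs → (∀ {z} → z ∈ˡ xs → z ∈ˡ ys) →
                     length xs ≤ length ys
  unique-⊆⇒length≤ {[]} _ _ = z≤n
  unique-⊆⇒length≤ {x ∷ xs} {ys} (x∉xs ∷ xs-unique) xs⊆ys =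
    ≤-trans (s≤s (unique-⊆⇒length≤ xs-unique xs⊆ys─x))
            (≤-reflexive (≡.sym (length-removeAt′ ys (index x∈ys))))
    where
    x∈ys : x ∈ˡ ys
    x∈ys = xs⊆ys (here refl)
    xs⊆ys─x : ∀ {z} → z ∈ˡ xs → z ∈ˡ ys ─ x∈ys
    xs⊆ys─x z∈xs = ∈-─⁺ x∈ys (xs⊆ys (there z∈xs)) λ { refl → All.lookup x∉xs z∈xs refl }

  record Enumeration (P : A → Set) (xs : List A) : Set where
    field
      unique   : Unique xs
      sound    : All P xs
      complete : ∀ {x} → P x → x ∈ˡ xs

  open Enumeration public

  enumeration-length : ∀ {P xs ys} → Enumeration P xs → Enumeration P ys → length xs ≡ length ys
  enumeration-length e f = ≤-antisym (unique-⊆⇒length≤ (unique e) (complete f ∘ All.lookup (sound e)))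
                                     (unique-⊆⇒length≤ (unique f) (complete e ∘ All.lookup (sound f)))

  enumeration-map : ∀ {P Q xs} → (∀ {x} → P x → Q x) → (∀ {x} → Q x → P x) →
                    Enumeration P xs → Enumeration Q xs
  enumeration-map P⇒Q Q⇒P e = record
    { unique = unique e ; sound = All.map P⇒Q (sound e) ; complete = complete e ∘ Q⇒P }

  All-disjoint : ∀ {P Q : A → Set} {xs ys} → All P xs → All Q ys → (∀ {x} → P x → Q x → ⊥) →
                 Disjoint xs ys
  All-disjoint Pxs Qys P∩Q=∅ (x∈xs , x∈ys) = P∩Q=∅ (All.lookup Pxs x∈xs) (All.lookup Qys x∈ys)

  Unique-resp-↭ : ∀ {xs ys : List A} → xs ↭ ys → Unique xs → Unique ys
  Unique-resp-↭ xs↭ys = Permₛ.Unique-resp-↭ (≡.setoid A) (↭⇒↭ₛ xs↭ys)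

  ∈⇒↭∷ : ∀ {x} {xs : List A} → x ∈ˡ xs → ∃ λ ys → xs ↭ x ∷ ys
  ∈⇒↭∷ x∈xs with ys , zs , refl ← ∈-∃++ x∈xs = ys ++ zs , shift _ ys zs

  weave : List A → List A → List A
  weave (x ∷ xs) (y ∷ ys) = x ∷ y ∷ weave xs ys
  weave []       ys       = ys
  weave xs       []       = xs

  weave-↭ : ∀ xs ys → weave xs ys ↭ xs ++ ys
  weave-↭ (x ∷ xs) (y ∷ ys) = ↭-prep x (↭-trans (↭-prep y (weave-↭ xs ys)) (↭-sym (shift y xs ys)))
  weave-↭ []       ys       = ↭-refl
  weave-↭ (x ∷ xs) []       = ↭-sym (++-identityʳ (x ∷ xs))

2*m≤1+2*n⇒m≤n : ∀ {m n} → 2 * m ≤ suc (2 * n) → m ≤ n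
2*m≤1+2*n⇒m≤n {m} {n} 2m≤1+2n = ≮⇒≥ λ n<m →
  <-irrefl refl (≤-trans (≤-reflexive (≡.sym (*-suc 2 n))) (≤-trans (*-monoʳ-≤ 2 n<m) 2m≤1+2n))

4≤2+x+y⇒2≤x+y : ∀ x y → 4 ≤ suc x + suc y → 2 ≤ x + y
4≤2+x+y⇒2≤x+y x y 4≤ = s≤s⁻¹ (s≤s⁻¹ (subst (4 ≤_) (cong suc (+-suc x y)) 4≤))

toList : ∀ {n} → Subset n → List (Fin n)
toList []            = []
toList (inside  ∷ p) = zero ∷ map suc (toList p)
toList (outside ∷ p) = map suc (toList p)

length-toList : ∀ {n} (p : Subset n) → length (toList p) ≡ ∣ p ∣
length-toList []            = refl
length-toList (inside  ∷ p) = cong suc (trans (length-map suc (toList p)) (length-toList p))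
length-toList (outside ∷ p) = trans (length-map suc (toList p)) (length-toList p)

toList-enumeration : ∀ {n} (p : Subset n) → Enumeration (_∈ p) (toList p)
toList-enumeration [] = record { unique = [] ; sound = [] ; complete = λ () }
toList-enumeration (inside ∷ p) = record
  { unique   = All.tabulate (λ q → zero≢suc (∈-map⁻ suc q)) ∷ Uniqueₚ.map⁺ Finₚ.suc-injective (unique e)
  ; sound    = here ∷ All-map⁺ (All.map there (sound e))
  ; complete = λ { here → here refl ; (there x∈p) → there (∈-map⁺ suc (complete e x∈p)) }
  }
  where
  e : Enumeration (_∈ p) (toList p)
  e = toList-enumeration p
  zero≢suc : ∀ {y} → ∃ (λ x → x ∈ˡ toList p × y ≡ suc x) → zero ≢ y
  zero≢suc (_ , _ , refl) ()
toList-enumeration (outside ∷ p) = record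
  { unique   = Uniqueₚ.map⁺ Finₚ.suc-injective (unique (toList-enumeration p))
  ; sound    = All-map⁺ (All.map there (sound (toList-enumeration p)))
  ; complete = λ { (there x∈p) → ∈-map⁺ suc (complete (toList-enumeration p) x∈p) }
  }

module _ {n : ℕ} where

  ∣∣≡length : ∀ {p : Subset n} {xs} → Enumeration (_∈ p) xs → ∣ p ∣ ≡ length xs
  ∣∣≡length {p} e = trans (≡.sym (length-toList p)) (enumeration-length (toList-enumeration p) e)

  ∃∉-of-∣∣<length : ∀ (X : Subset n) {xs} → Unique xs → ∣ X ∣ < length xs → ∃ λ x → x ∈ˡ xs × x ∉ X
  ∃∉-of-∣∣<length X {xs} xs-unique ∣X∣<∣xs∣ with All.all? (_∈? X) xs
  ... | no xs⊈X = find (¬All⇒Any¬ (_∈? X) xs xs⊈X)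
  ... | yes xs⊆X = contradiction
    (≤-trans (unique-⊆⇒length≤ xs-unique (complete (toList-enumeration X) ∘ All.lookup xs⊆X))
             (≤-reflexive (length-toList X)))
    (<⇒≱ ∣X∣<∣xs∣)

  module _ {P : Fin n → Set} (P? : Decidable P) where

    subsetOf : Subset n
    subsetOf = tabulate (does ∘ P?)

    ∈-subsetOf⁺ : ∀ {x} → P x → x ∈ subsetOf
    ∈-subsetOf⁺ {x} Px = lookup⇒[]= x subsetOf (trans (lookup∘tabulate (does ∘ P?) x) (dec-true (P? x) Px))

    ∈-subsetOf⁻ : ∀ {x} → x ∈ subsetOf → P x
    ∈-subsetOf⁻ {x} x∈ with P? x | trans (≡.sym (lookup∘tabulate (does ∘ P?) x)) ([]=⇒lookup x∈)
    ... | yes Px | _ = Px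
    ... | no _   | ()

module _ {v : ℕ} (G : Graph v) where

  edge-sym : ∀ {x y} → Edge G x y → Edge G y x
  edge-sym {x} {y} e = trans (sym G y x) e

  Apart : Fin v → Fin v → Set
  Apart x y = x ≢ y × ¬ Edge G x y

  apart-sym : ∀ {x y} → Apart x y → Apart y x
  apart-sym (x≢y , ¬xy) = x≢y ∘ ≡.sym , ¬xy ∘ edge-sym

  apart-pairs : ∀ {l} → Unique l → (∀ {x y} → x ∈ˡ l → y ∈ˡ l → ¬ Edge G x y) → AllPairs Apart l
  apart-pairs {[]} _ _ = []
  apart-pairs {x ∷ l} (x∉l ∷ l-unique) non-adjacent =
    All.tabulate (λ y∈l → All.lookup x∉l y∈l , non-adjacent (here refl) (there y∈l))
    ∷ apart-pairs l-unique (λ x∈l y∈l → non-adjacent (there x∈l) (there y∈l))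

  length-endpoints : ∀ M → length (endpoints G M) ≡ 2 * length M
  length-endpoints []      = refl
  length-endpoints (_ ∷ M) = trans (cong (2 +_) (length-endpoints M)) (≡.sym (*-suc 2 (length M)))

  PerfectMatchingWithout : Fin v → Set
  PerfectMatchingWithout x = ∃ λ M → IsMatching G M × ¬ Covered G x M × (∀ y → ¬ y ≡ x → Covered G y M)

  module _ {X : Subset v} where

    walk-start : ∀ {x y} → WalkIn G X x y → x ∈ X
    walk-start (here x∈X)     = x∈X
    walk-start (step x∈X _ _) = x∈X

    _◅◅_ : ∀ {x y z} → WalkIn G X x y → WalkIn G X y z → WalkIn G X x z
    here _         ◅◅ w′ = w′
    step x∈X e w   ◅◅ w′ = step x∈X e (w ◅◅ w′)

    reverse : ∀ {x y} → WalkIn G X x y → WalkIn G X y x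
    reverse (here x∈X)     = here x∈X
    reverse (step x∈X e w) = reverse w ◅◅ step (walk-start w) (edge-sym e) (here x∈X)

    connected-via-hub : ∀ {s} → s ∈ X → (∀ u → u ∈ X → WalkIn G X u s) → ConnectedIn G X
    connected-via-hub s∈X to-hub = (_ , s∈X) , λ x y x∈X y∈X → to-hub x x∈X ◅◅ reverse (to-hub y y∈X)

data Part : Set where
  cut left right : Part

_≟ₚ_ : DecidableEquality Part
cut   ≟ₚ cut   = yes refl
left  ≟ₚ left  = yes refl
right ≟ₚ right = yes refl
cut   ≟ₚ left  = no λ ()
cut   ≟ₚ right = no λ ()
left  ≟ₚ cut   = no λ ()
left  ≟ₚ right = no λ ()
right ≟ₚ cut   = no λ ()
right ≟ₚ left  = no λ ()

joins : Part → Part → Bool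
joins cut   cut   = false
joins left  right = false
joins right left  = false
joins _     _     = true

joins-sym : ∀ p q → joins p q ≡ joins q p
joins-sym cut   cut   = refl
joins-sym cut   left  = refl
joins-sym cut   right = refl
joins-sym left  cut   = refl
joins-sym left  left  = refl
joins-sym left  right = refl
joins-sym right cut   = refl
joins-sym right left  = refl
joins-sym right right = refl

joins-cut : ∀ {q} → q ≢ cut → joins cut q ≡ true
joins-cut {cut}   q≢cut = ⊥-elim (q≢cut refl)
joins-cut {left}  _     = refl
joins-cut {right} _     = refl

joins-self : ∀ {p} → p ≢ cut → joins p p ≡ true
joins-self {cut}   p≢cut = ⊥-elim (p≢cut refl)
joins-self {left}  _     = refl
joins-self {right} _     = refl

non-joining-triple : ∀ p q r → joins p q ≡ false → joins p r ≡ false → joins q r ≡ false → p ≡ cut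
non-joining-triple cut   _     _     _  _  _  = refl
non-joining-triple left  cut   _     () _  _
non-joining-triple left  left  _     () _  _
non-joining-triple left  right cut   _  () _
non-joining-triple left  right left  _  () _
non-joining-triple left  right right _  _  ()
non-joining-triple right cut   _     () _  _
non-joining-triple right left  cut   _  () _
non-joining-triple right left  left  _  _  ()
non-joining-triple right left  right _  () _
non-joining-triple right right _     () _  _

joins-outside-cut : ∀ {p q} → joins p q ≡ true → p ≢ cut → q ≢ cut → p ≡ q
joins-outside-cut {cut}             _  p≢cut _     = ⊥-elim (p≢cut refl)
joins-outside-cut {_}     {cut}     _  _     q≢cut = ⊥-elim (q≢cut refl)
joins-outside-cut {left}  {left}    _  _     _     = refl
joins-outside-cut {right} {right}   _  _     _     = refl
joins-outside-cut {left}  {right}   ()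
joins-outside-cut {right} {left}    ()

module Partitioned {v : ℕ} (part : Fin v → Part) where

  adjacency : Fin v → Fin v → Bool
  adjacency x y = if does (x Finₚ.≟ y) then false else joins (part x) (part y)

  adjacency-sym : ∀ x y → adjacency x y ≡ adjacency y x
  adjacency-sym x y with x Finₚ.≟ y | y Finₚ.≟ x
  ... | yes _   | yes _   = refl
  ... | no _    | no _    = joins-sym (part x) (part y)
  ... | yes x≡y | no y≢x  = ⊥-elim (y≢x (≡.sym x≡y))
  ... | no x≢y  | yes y≡x = ⊥-elim (x≢y (≡.sym y≡x))

  adjacency-irrefl : ∀ x → adjacency x x ≡ false
  adjacency-irrefl x with x Finₚ.≟ x
  ... | yes _   = refl
  ... | no x≢x = ⊥-elim (x≢x refl)

  graph : Graph v
  graph = record { adj = adjacency ; sym = adjacency-sym ; irrefl = adjacency-irrefl }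

  edge : ∀ {x y} → x ≢ y → joins (part x) (part y) ≡ true → Edge graph x y
  edge {x} {y} x≢y xy-join with x Finₚ.≟ y
  ... | yes x≡y = ⊥-elim (x≢y x≡y)
  ... | no _    = xy-join

  edge-joins : ∀ {x y} → Edge graph x y → joins (part x) (part y) ≡ true
  edge-joins {x} {y} e with x Finₚ.≟ y
  ... | no _ = e

  block-joins : ∀ {p x y} → p ≢ cut → part x ≡ p → part y ≡ p → joins (part x) (part y) ≡ true
  block-joins {x = x} p≢cut refl py = subst (λ q → joins (part x) q ≡ true) (≡.sym py) (joins-self p≢cut)

  cut-joins : ∀ {s x} → part s ≡ cut → part x ≢ cut → joins (part s) (part x) ≡ true
  cut-joins {x = x} ps px≢cut = subst (λ p → joins p (part x) ≡ true) (≡.sym ps) (joins-cut px≢cut)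

  cut-edge : ∀ {s x} → part s ≡ cut → part x ≢ cut → Edge graph s x
  cut-edge {s} {x} ps px≢cut = edge {s} {x} (λ { refl → px≢cut ps }) (cut-joins ps px≢cut)

  apart⇒¬joins : ∀ {x y} → Apart graph x y → joins (part x) (part y) ≡ false
  apart⇒¬joins (x≢y , ¬xy) = ¬-not (¬xy ∘ edge x≢y)

  apart-triple-in-cut : ∀ {x y z} → Apart graph x y → Apart graph x z → Apart graph y z → part x ≡ cut
  apart-triple-in-cut xy xz yz = non-joining-triple _ _ _ (apart⇒¬joins xy) (apart⇒¬joins xz) (apart⇒¬joins yz)

  independent-in-cut : ∀ {l} → AllPairs (Apart graph) l → 3 ≤ length l → All (λ x → part x ≡ cut) l
  independent-in-cut {_ ∷ _ ∷ _ ∷ _} ((pq ∷ pr ∷ pts) ∷ (qr ∷ qts) ∷ _) _ =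
    apart-triple-in-cut pq pr qr
    ∷ apart-triple-in-cut (apart-sym graph pq) qr pr
    ∷ apart-triple-in-cut (apart-sym graph pr) (apart-sym graph qr) pq
    ∷ All.zipWith (λ (pt , qt) → apart-triple-in-cut (apart-sym graph pt) (apart-sym graph qt) pq) (pts , qts)
  independent-in-cut {[]}             _ ()
  independent-in-cut {_ ∷ []}         _ (s≤s ())
  independent-in-cut {_ ∷ _ ∷ []}     _ (s≤s (s≤s ()))

  connected-via-cut : ∀ {X s w} → s ∈ X → w ∈ X → part s ≡ cut → part w ≢ cut → ConnectedIn graph X
  connected-via-cut {X} {s} {w} s∈X w∈X ps pw≢cut = connected-via-hub graph s∈X to-s
    where
    to-s : ∀ u → u ∈ X → WalkIn graph X u s
    to-s u u∈X with part u ≟ₚ cut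
    ... | no pu≢cut = step u∈X (edge-sym graph (cut-edge ps pu≢cut)) (here s∈X)
    ... | yes pu    = step u∈X (cut-edge pu pw≢cut) (step w∈X (edge-sym graph (cut-edge ps pw≢cut)) (here s∈X))

  in-block? : ∀ p → Decidable (λ x → part x ≡ p)
  in-block? p x = part x ≟ₚ p

  block : Part → Subset v
  block p = subsetOf (in-block? p)

  block-connected : ∀ {p x} → p ≢ cut → part x ≡ p → ConnectedIn graph (block p)
  block-connected {p} {x} p≢cut px = (x , ∈-subsetOf⁺ (in-block? _) px) , walk
    where
    walk : ∀ y z → y ∈ block p → z ∈ block p → WalkIn graph (block p) y z
    walk y z y∈ z∈ with y Finₚ.≟ z
    ... | yes refl = here y∈
    ... | no y≢z   = step y∈ (edge {y} {z} y≢z (block-joins p≢cut (∈-subsetOf⁻ (in-block? _) y∈)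
                                                               (∈-subsetOf⁻ (in-block? _) z∈)))
                              (here z∈)

  ∣block∣≡length : ∀ {p xs} → Enumeration (λ x → part x ≡ p) xs → ∣ block p ∣ ≡ length xs
  ∣block∣≡length = ∣∣≡length ∘ enumeration-map (∈-subsetOf⁺ (in-block? _)) (∈-subsetOf⁻ (in-block? _))

  ∉-other-block : ∀ {p q x} → part x ≡ p → p ≢ q → x ∉ block q
  ∉-other-block px p≢q x∈q = p≢q (trans (≡.sym px) (∈-subsetOf⁻ (in-block? _) x∈q))

  block-trichotomy : ∀ x →
    (x ∈ block cut × x ∉ block left × x ∉ block right) ⊎
    ((x ∉ block cut × x ∈ block left × x ∉ block right) ⊎ (x ∉ block cut × x ∉ block left × x ∈ block right))
  block-trichotomy x with part x in px
  ... | cut   = inj₁ (∈-subsetOf⁺ (in-block? cut) px , ∉-other-block px (λ ()) , ∉-other-block px (λ ()))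
  ... | left  = inj₂ (inj₁ (∉-other-block px (λ ()) , ∈-subsetOf⁺ (in-block? left) px , ∉-other-block px (λ ())))
  ... | right = inj₂ (inj₂ (∉-other-block px (λ ()) , ∉-other-block px (λ ()) , ∈-subsetOf⁺ (in-block? right) px))

  non-joining-blocks : ∀ {p q} → joins p q ≡ false → ∀ x y → x ∈ block p → y ∈ block q → ¬ Edge graph x y
  non-joining-blocks ¬pq x y x∈ y∈ xy
    with () ← trans (≡.sym ¬pq) (subst₂ (λ p q → joins p q ≡ true) (∈-subsetOf⁻ (in-block? _) x∈)
                                        (∈-subsetOf⁻ (in-block? _) y∈) (edge-joins {x} {y} xy))

  data Pairing : List (Fin v) → Set where
    []     : Pairing []
    joined : ∀ {x y l} → joins (part x) (part y) ≡ true → Pairing l → Pairing (x ∷ y ∷ l)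

  _++ᵖ_ : ∀ {xs ys} → Pairing xs → Pairing ys → Pairing (xs ++ ys)
  []           ++ᵖ q = q
  joined xy p  ++ᵖ q = joined xy (p ++ᵖ q)

  pairs : List (Fin v) → List (Fin v × Fin v)
  pairs (x ∷ y ∷ l) = (x , y) ∷ pairs l
  pairs _           = []

  endpoints-pairs : ∀ {l} → Pairing l → endpoints graph (pairs l) ≡ l
  endpoints-pairs []                   = refl
  endpoints-pairs (joined {x} {y} _ p) = cong (λ l → x ∷ y ∷ l) (endpoints-pairs p)

  pairing-matching : ∀ {l} → Unique l → Pairing l → IsMatching graph (pairs l)
  pairing-matching []                              []                   = [] , []
  pairing-matching l-unique@((x≢y ∷ _) ∷ _ ∷ rest) (joined xy-join p) =
    edge x≢y xy-join ∷ proj₁ (pairing-matching rest p) ,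
    subst Unique (≡.sym (endpoints-pairs (joined xy-join p))) l-unique

  perfect-matching-without : ∀ {x L} → Unique (x ∷ L) → (∀ y → y ∈ˡ x ∷ L) → Pairing L →
                             PerfectMatchingWithout graph x
  perfect-matching-without {x} {L} (x∉L ∷ L-unique) everything p =
    pairs L , pairing-matching L-unique p ,
    (λ x∈ → All.lookup x∉L (subst (x ∈ˡ_) (endpoints-pairs p) x∈) refl) ,
    λ y y≢x → subst (y ∈ˡ_) (≡.sym (endpoints-pairs p)) (others y y≢x)
    where
    others : ∀ y → y ≢ x → y ∈ˡ L
    others y y≢x with everything y
    ... | here y≡x  = ⊥-elim (y≢x y≡x)
    ... | there y∈L = y∈L

  block-pairing : ∀ {p} → p ≢ cut → ∀ k {l} → All (λ x → part x ≡ p) l → length l ≡ 2 * k → Pairing l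
  block-pairing     p≢cut zero    {[]} _  _   = []
  block-pairing {p} p≢cut (suc k) {l}  pl |l| = pairing-of-length (trans |l| (*-suc 2 k)) pl
    where
    pairing-of-length : ∀ {l} → length l ≡ suc (suc (2 * k)) → All (λ x → part x ≡ p) l → Pairing l
    pairing-of-length {_ ∷ _ ∷ _} |l| (px ∷ py ∷ pl) =
      joined (block-joins p≢cut px py) (block-pairing p≢cut k pl (suc-injective (suc-injective |l|)))

  cut-block-pairing : ∀ {s p} → part s ≡ cut → p ≢ cut → ∀ k {l} → All (λ x → part x ≡ p) l →
                      length l ≡ suc (2 * k) → Pairing (s ∷ l)
  cut-block-pairing ps p≢cut k {_ ∷ _} (px ∷ pl) |l| =
    joined (cut-joins ps (λ px≡cut → p≢cut (trans (≡.sym px) px≡cut)))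
           (block-pairing p≢cut k pl (suc-injective |l|))

  -- s₀ takes the head of the odd block ds; s₁ and s₂ take the next two vertices of ds ++ rest.
  weave-pairing : ∀ {s₀ s₁ s₂ ds rest} → All (λ s → part s ≡ cut) (s₀ ∷ s₁ ∷ s₂ ∷ []) →
                  All (λ x → part x ≢ cut) (ds ++ rest) → Pairing (s₀ ∷ ds) → Pairing rest →
                  1 < length (ds ++ rest) → Pairing (weave (s₀ ∷ s₁ ∷ s₂ ∷ []) (ds ++ rest))
  weave-pairing (_ ∷ p₁ ∷ p₂ ∷ []) (_ ∷ n₁ ∷ n₂ ∷ _) (joined j₀ (joined _ p)) q _ =
    joined j₀ (joined (cut-joins p₁ n₁) (joined (cut-joins p₂ n₂) (p ++ᵖ q)))
  weave-pairing (_ ∷ p₁ ∷ p₂ ∷ []) (_ ∷ n₁ ∷ n₂ ∷ _) (joined j₀ []) (joined _ q) _ =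
    joined j₀ (joined (cut-joins p₁ n₁) (joined (cut-joins p₂ n₂) q))
  weave-pairing _ _ (joined _ []) [] (s≤s ())

  length-filter-pair : ∀ p {x y} l → part x ≡ part y →
    length (filter (in-block? p) (x ∷ y ∷ l)) ≡ length (filter (in-block? p) l) ⊎
    length (filter (in-block? p) (x ∷ y ∷ l)) ≡ 2 + length (filter (in-block? p) l)
  length-filter-pair p {x} {y} l px≡py with part x ≟ₚ p
  ... | no px≢p = inj₁ (cong length (filter-reject (in-block? p) (px≢p ∘ trans px≡py)))
  ... | yes px  = inj₂ (cong (suc ∘ length) (filter-accept (in-block? p) (trans (≡.sym px≡py) px)))

  block-endpoints-even : ∀ p {M} → IsMatching graph M → (∀ s → part s ≡ cut → ¬ Covered graph s M) →
                         ∃ λ k → length (filter (in-block? p) (endpoints graph M)) ≡ 2 * k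
  block-endpoints-even p {[]} _ _ = 0 , refl
  block-endpoints-even p {(x , y) ∷ M} (xy ∷ es , _ ∷ _ ∷ ep-unique) cut-uncovered
    with k , |M| ← block-endpoints-even p (es , ep-unique) (λ s ps c → cut-uncovered s ps (there (there c)))
    with length-filter-pair p (endpoints graph M)
           (joins-outside-cut (edge-joins {x} {y} xy) (λ px → cut-uncovered x px (here refl))
                                              (λ py → cut-uncovered y py (there (here refl))))
  ... | inj₁ same = k , trans same |M|
  ... | inj₂ more = suc k , trans more (trans (cong (2 +_) |M|) (≡.sym (*-suc 2 k)))

module Layout (m n : ℕ) where

  v : ℕ
  v = 3 + (m + n)

  cutV : Fin 3 → Fin v
  cutV i = i ↑ˡ (m + n)

  leftV : Fin m → Fin v
  leftV i = 3 ↑ʳ (i ↑ˡ n)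

  rightV : Fin n → Fin v
  rightV j = 3 ↑ʳ (m ↑ʳ j)

  part : Fin v → Part
  part x = [ const cut , [ const left , const right ]′ ∘ splitAt m ]′ (splitAt 3 x)

  open Partitioned part public

  part-cutV : ∀ i → part (cutV i) ≡ cut
  part-cutV i rewrite Finₚ.splitAt-↑ˡ 3 i (m + n) = refl

  part-leftV : ∀ i → part (leftV i) ≡ left
  part-leftV i rewrite Finₚ.splitAt-↑ʳ 3 (m + n) (i ↑ˡ n) | Finₚ.splitAt-↑ˡ m i n = refl

  part-rightV : ∀ j → part (rightV j) ≡ right
  part-rightV j rewrite Finₚ.splitAt-↑ʳ 3 (m + n) (m ↑ʳ j) | Finₚ.splitAt-↑ʳ m n j = refl

  data View : Fin v → Set where
    inCut   : ∀ i → View (cutV i)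
    inLeft  : ∀ i → View (leftV i)
    inRight : ∀ j → View (rightV j)

  view : ∀ x → View x
  view x with splitAt 3 x in x≡
  ... | inj₁ i = subst View (Finₚ.splitAt⁻¹-↑ˡ x≡) (inCut i)
  ... | inj₂ y with splitAt m y in y≡
  ...   | inj₁ i = subst View (trans (cong (3 ↑ʳ_) (Finₚ.splitAt⁻¹-↑ˡ y≡)) (Finₚ.splitAt⁻¹-↑ʳ x≡)) (inLeft i)
  ...   | inj₂ j = subst View (trans (cong (3 ↑ʳ_) (Finₚ.splitAt⁻¹-↑ʳ y≡)) (Finₚ.splitAt⁻¹-↑ʳ x≡)) (inRight j)

  members : Part → List (Fin v)
  members cut   = map cutV (allFin 3)
  members left  = map leftV (allFin m)
  members right = map rightV (allFin n)

  ∈-members : ∀ x → x ∈ˡ members (part x)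
  ∈-members x with view x
  ... | inCut i   rewrite part-cutV i   = ∈-map⁺ cutV (∈-allFin i)
  ... | inLeft i  rewrite part-leftV i  = ∈-map⁺ leftV (∈-allFin i)
  ... | inRight j rewrite part-rightV j = ∈-map⁺ rightV (∈-allFin j)

  members-enumeration : ∀ p → Enumeration (λ x → part x ≡ p) (members p)
  members-enumeration p = record
    { unique   = unique-members p
    ; sound    = sound-members p
    ; complete = λ {x} px → subst (λ q → x ∈ˡ members q) px (∈-members x)
    }
    where
    unique-members : ∀ p → Unique (members p)
    unique-members cut   = Uniqueₚ.map⁺ (Finₚ.↑ˡ-injective (m + n) _ _) (Uniqueₚ.allFin⁺ 3)
    unique-members left  = Uniqueₚ.map⁺ (Finₚ.↑ˡ-injective n _ _ ∘ Finₚ.↑ʳ-injective 3 _ _) (Uniqueₚ.allFin⁺ m)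
    unique-members right = Uniqueₚ.map⁺ (Finₚ.↑ʳ-injective m _ _ ∘ Finₚ.↑ʳ-injective 3 _ _) (Uniqueₚ.allFin⁺ n)
    sound-members : ∀ p → All (λ x → part x ≡ p) (members p)
    sound-members cut   = All-map⁺ {f = cutV} (All.universal part-cutV _)
    sound-members left  = All-map⁺ {f = leftV} (All.universal part-leftV _)
    sound-members right = All-map⁺ {f = rightV} (All.universal part-rightV _)

  length-members : ∀ {k} (f : Fin k → Fin v) → length (map f (allFin k)) ≡ k
  length-members {k} f = trans (length-map f (allFin k)) (length-tabulate {n = k} id)

  cuts lefts rights vertices : List (Fin v)
  cuts     = members cut
  lefts    = members left
  rights   = members right
  vertices = cuts ++ lefts ++ rights

  not-cut : ∀ {p} → p ≢ cut → ∀ {x} → part x ≡ p → part x ≢ cut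
  not-cut p≢cut px px≡cut = p≢cut (trans (≡.sym px) px≡cut)

  noncuts-unique : Unique (lefts ++ rights)
  noncuts-unique = Uniqueₚ.++⁺ (unique (members-enumeration left)) (unique (members-enumeration right))
    (All-disjoint (sound (members-enumeration left)) (sound (members-enumeration right))
                  λ pl pr → contradiction (trans (≡.sym pl) pr) λ ())

  noncuts-not-cut : All (λ x → part x ≢ cut) (lefts ++ rights)
  noncuts-not-cut = ++⁺ (All.map (λ {x} → not-cut (λ ()) {x}) (sound (members-enumeration left)))
                        (All.map (λ {x} → not-cut (λ ()) {x}) (sound (members-enumeration right)))

  vertices-unique : Unique vertices
  vertices-unique = Uniqueₚ.++⁺ (unique (members-enumeration cut)) noncuts-unique
    (All-disjoint (sound (members-enumeration cut)) noncuts-not-cut λ pc p≢cut → p≢cut pc)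

  ∈-vertices : ∀ x → x ∈ˡ vertices
  ∈-vertices x with part x | ∈-members x
  ... | cut   | x∈ = ∈-++⁺ˡ x∈
  ... | left  | x∈ = ∈-++⁺ʳ cuts (∈-++⁺ˡ x∈)
  ... | right | x∈ = ∈-++⁺ʳ cuts (∈-++⁺ʳ lefts x∈)

  three-connected : 4 ≤ m + n → KConnected graph 3
  three-connected 4≤m+n = s≤s (s≤s (s≤s (≤-trans (s≤s z≤n) 4≤m+n))) , λ X ∣X∣<3 →
    let s , s∈cuts , s∉X = ∃∉-of-∣∣<length X (unique (members-enumeration cut)) ∣X∣<3
        w , w∈noncuts , w∉X = ∃∉-of-∣∣<length X noncuts-unique
          (≤-trans ∣X∣<3 (subst (3 ≤_) (≡.sym |noncuts|) (≤-trans (n≤1+n 3) 4≤m+n)))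
    in connected-via-cut (x∉p⇒x∈∁p s∉X) (x∉p⇒x∈∁p w∉X)
         (All.lookup (sound (members-enumeration cut)) s∈cuts) (All.lookup noncuts-not-cut w∈noncuts)
    where
    |noncuts| : length (lefts ++ rights) ≡ m + n
    |noncuts| = trans (length-++ lefts) (≡.cong₂ _+_ (length-members leftV) (length-members rightV))

  independent-≤3 : ∀ X → Independent graph X → ∣ X ∣ ≤ 3
  independent-≤3 X X-independent with length (toList X) ≤? 2
  ... | yes ≤2 = subst (_≤ 3) (length-toList X) (m≤n⇒m≤1+n ≤2)
  ... | no ≰2  = subst (_≤ 3) (length-toList X)
    (unique-⊆⇒length≤ (unique X-list) (complete (members-enumeration cut) ∘ All.lookup X-in-cut))
    where
    X-list : Enumeration (_∈ X) (toList X)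
    X-list = toList-enumeration X
    X-in-cut : All (λ x → part x ≡ cut) (toList X)
    X-in-cut = independent-in-cut
      (apart-pairs graph (unique X-list)
        (λ x∈ y∈ → X-independent _ _ (All.lookup (sound X-list) x∈) (All.lookup (sound X-list) y∈)))
      (≰⇒> ≰2)

  independence-number : IndependenceNumber graph 3
  independence-number =
    (block cut , non-joining-blocks refl , ∣block∣≡length (members-enumeration cut)) , independent-≤3

order-odd : ∀ a b → 3 + (suc (2 * a) + suc (2 * b)) ≡ suc (2 * (2 + (a + b)))
order-odd = solve-∀

module OddBlocks (a b : ℕ) where

  open Layout (suc (2 * a)) (suc (2 * b)) public

  separation : TwoComponentsAfter graph (block cut) (block left) (block right)
  separation = block-trichotomy , block-connected {x = leftV zero} (λ ()) (part-leftV zero) ,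
               block-connected {x = rightV zero} (λ ()) (part-rightV zero) , non-joining-blocks refl

  perfect-matching-via : ∀ {x L} → vertices ↭ x ∷ L → Pairing L → PerfectMatchingWithout graph x
  perfect-matching-via vertices↭ =
    perfect-matching-without (Unique-resp-↭ vertices↭ vertices-unique) (λ y → ∈-resp-↭ vertices↭ (∈-vertices y))

  woven-perfect-matching : ∀ {x ds rest} → vertices ↭ x ∷ cuts ++ ds ++ rest → Pairing (cutV zero ∷ ds) →
    Pairing rest → All (λ y → part y ≢ cut) (ds ++ rest) → 2 ≤ length ds + length rest →
    PerfectMatchingWithout graph x
  woven-perfect-matching {x} {ds} {rest} vertices↭ pds prest noncut long =
    perfect-matching-via (↭-trans vertices↭ (↭-prep x (↭-sym (weave-↭ cuts (ds ++ rest)))))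
                         (weave-pairing (sound (members-enumeration cut)) noncut pds prest long′)
    where
    long′ : 1 < length (ds ++ rest)
    long′ = subst (2 ≤_) (≡.sym (length-++ ds)) long

  cut-perfect-matching : ∀ {x ts} → cuts ↭ x ∷ ts → PerfectMatchingWithout graph x
  cut-perfect-matching {x} {t₁ ∷ t₂ ∷ []} cuts↭ = perfect-matching-via perm
    (cut-block-pairing (All.head ts-cut) (λ ()) a (sound (members-enumeration left)) (length-members leftV)
     ++ᵖ cut-block-pairing (All.head (All.tail ts-cut)) (λ ()) b (sound (members-enumeration right))
                                                                  (length-members rightV))
    where
    open PermutationReasoning
    ts-cut : All (λ t → part t ≡ cut) (t₁ ∷ t₂ ∷ [])
    ts-cut = All.tail (All-resp-↭ cuts↭ (sound (members-enumeration cut)))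
    perm : vertices ↭ x ∷ (t₁ ∷ lefts) ++ t₂ ∷ rights
    perm = begin
      cuts ++ lefts ++ rights            ↭⟨ ++⁺ʳ (lefts ++ rights) cuts↭ ⟩
      x ∷ t₁ ∷ t₂ ∷ lefts ++ rights      ↭⟨ ↭-prep x (↭-prep t₁ (↭-sym (shift t₂ lefts rights))) ⟩
      x ∷ t₁ ∷ lefts ++ t₂ ∷ rights      ∎
  cut-perfect-matching {ts = []}            cuts↭ = contradiction (↭-length cuts↭) λ ()
  cut-perfect-matching {ts = _ ∷ []}        cuts↭ = contradiction (↭-length cuts↭) λ ()
  cut-perfect-matching {ts = _ ∷ _ ∷ _ ∷ _} cuts↭ = contradiction (↭-length cuts↭) λ ()

  left-perfect-matching : ∀ {x} → 4 ≤ suc (2 * a) + suc (2 * b) → part x ≡ left →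
                          PerfectMatchingWithout graph x
  left-perfect-matching {x} large px with ra , lefts↭ ← ∈⇒↭∷ (complete (members-enumeration left) px) =
    woven-perfect-matching perm
      (cut-block-pairing (part-cutV zero) (λ ()) b (sound (members-enumeration right)) (length-members rightV))
      (block-pairing (λ ()) a ra-left |ra|)
      (++⁺ (All.map (λ {y} → not-cut (λ ()) {y}) (sound (members-enumeration right)))
           (All.map (λ {y} → not-cut (λ ()) {y}) ra-left))
      (subst₂ (λ k l → 2 ≤ k + l) (≡.sym (length-members rightV)) (≡.sym |ra|)
              (m≤n⇒m≤1+n (subst (2 ≤_) (+-comm (2 * a) (2 * b)) (4≤2+x+y⇒2≤x+y (2 * a) (2 * b) large))))
    where
    open PermutationReasoning
    ra-left : All (λ y → part y ≡ left) ra
    ra-left = All.tail (All-resp-↭ lefts↭ (sound (members-enumeration left)))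
    |ra| : length ra ≡ 2 * a
    |ra| = suc-injective (trans (≡.sym (↭-length lefts↭)) (length-members leftV))
    perm : vertices ↭ x ∷ cuts ++ rights ++ ra
    perm = begin
      cuts ++ lefts ++ rights       ↭⟨ ++⁺ˡ cuts (++⁺ʳ rights lefts↭) ⟩
      cuts ++ (x ∷ ra) ++ rights    ↭⟨ shift x cuts (ra ++ rights) ⟩
      x ∷ cuts ++ ra ++ rights      ↭⟨ ↭-prep x (++⁺ˡ cuts (++-comm ra rights)) ⟩
      x ∷ cuts ++ rights ++ ra      ∎

  right-perfect-matching : ∀ {x} → 4 ≤ suc (2 * a) + suc (2 * b) → part x ≡ right →
                           PerfectMatchingWithout graph x
  right-perfect-matching {x} large px with rb , rights↭ ← ∈⇒↭∷ (complete (members-enumeration right) px) =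
    woven-perfect-matching perm
      (cut-block-pairing (part-cutV zero) (λ ()) a (sound (members-enumeration left)) (length-members leftV))
      (block-pairing (λ ()) b rb-right |rb|)
      (++⁺ (All.map (λ {y} → not-cut (λ ()) {y}) (sound (members-enumeration left)))
           (All.map (λ {y} → not-cut (λ ()) {y}) rb-right))
      (subst₂ (λ k l → 2 ≤ k + l) (≡.sym (length-members leftV)) (≡.sym |rb|)
              (m≤n⇒m≤1+n (4≤2+x+y⇒2≤x+y (2 * a) (2 * b) large)))
    where
    open PermutationReasoning
    rb-right : All (λ y → part y ≡ right) rb
    rb-right = All.tail (All-resp-↭ rights↭ (sound (members-enumeration right)))
    |rb| : length rb ≡ 2 * b
    |rb| = suc-injective (trans (≡.sym (↭-length rights↭)) (length-members rightV))
    perm : vertices ↭ x ∷ cuts ++ lefts ++ rb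
    perm = begin
      cuts ++ lefts ++ rights       ↭⟨ ++⁺ˡ cuts (++⁺ˡ lefts rights↭) ⟩
      cuts ++ lefts ++ x ∷ rb       ↭⟨ ++⁺ˡ cuts (shift x lefts rb) ⟩
      cuts ++ x ∷ lefts ++ rb       ↭⟨ shift x cuts (lefts ++ rb) ⟩
      x ∷ cuts ++ lefts ++ rb       ∎

  factor-critical : 4 ≤ suc (2 * a) + suc (2 * b) → FactorCritical graph
  factor-critical large x with part x in px
  ... | cut   = cut-perfect-matching (proj₂ (∈⇒↭∷ (complete (members-enumeration cut) px)))
  ... | left  = left-perfect-matching large px
  ... | right = right-perfect-matching large px

  half : ℕ
  half = 2 + (a + b)

  order≡1+2*half : length (allFin v) ≡ suc (2 * half)
  order≡1+2*half = trans (length-tabulate {n = v} id) (order-odd a b)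

  matching-≤ : ∀ {M} → IsMatching graph M → length M ≤ half
  matching-≤ {M} (_ , ep-unique) = 2*m≤1+2*n⇒m≤n (begin
    2 * length M                 ≡⟨ ≡.sym (length-endpoints graph M) ⟩
    length (endpoints graph M)   ≤⟨ unique-⊆⇒length≤ ep-unique (λ {z} _ → ∈-allFin z) ⟩
    length (allFin v)            ≡⟨ order≡1+2*half ⟩
    suc (2 * half)               ∎)
    where open ≤-Reasoning

  open DecMembership (Finₚ._≟_ {v}) using () renaming (_∈?_ to _∈ˡ?_)

  uncovered? : ∀ M → Decidable (λ x → ¬ Covered graph x M)
  uncovered? M x = ¬? (x ∈ˡ? endpoints graph M)

  uncovered : List (Fin v × Fin v) → List (Fin v)
  uncovered M = filter (uncovered? M) (allFin v)

  covered-or-uncovered : ∀ M → suc (2 * half) ≤ length (endpoints graph M) + length (uncovered M)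
  covered-or-uncovered M = begin
    suc (2 * half)                                      ≡⟨ ≡.sym order≡1+2*half ⟩
    length (allFin v)                                   ≤⟨ unique-⊆⇒length≤ (Uniqueₚ.allFin⁺ v) covered-or-not ⟩
    length (endpoints graph M ++ uncovered M)           ≡⟨ length-++ (endpoints graph M) ⟩
    length (endpoints graph M) + length (uncovered M)   ∎
    where
    open ≤-Reasoning
    covered-or-not : ∀ {z} → z ∈ˡ allFin v → z ∈ˡ endpoints graph M ++ uncovered M
    covered-or-not {z} z∈ with z ∈ˡ? endpoints graph M
    ... | yes covered = ∈-++⁺ˡ covered
    ... | no uncovered-z = ∈-++⁺ʳ (endpoints graph M) (∈-filter⁺ (uncovered? M) z∈ uncovered-z)

  module MaximalMatching {M : List (Fin v × Fin v)} (M-maximal : IsMaximal graph M) where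

    U : List (Fin v)
    U = uncovered M

    U-unique : Unique U
    U-unique = Uniqueₚ.filter⁺ (uncovered? M) (Uniqueₚ.allFin⁺ v)

    U-uncovered : ∀ {x} → x ∈ˡ U → ¬ Covered graph x M
    U-uncovered = proj₂ ∘ ∈-filter⁻ (uncovered? M)

    U-independent : AllPairs (Apart graph) U
    U-independent = apart-pairs graph U-unique
      (λ x∈U y∈U xy → proj₂ M-maximal _ _ xy (U-uncovered x∈U) (U-uncovered y∈U))

    -- Three uncovered vertices force S to be uncovered and the clique K_m to be perfectly matched.
    module _ (3≤|U| : 3 ≤ length U) where

      U-in-cut : All (λ x → part x ≡ cut) U
      U-in-cut = independent-in-cut U-independent 3≤|U|

      cut-uncovered : ∀ s → part s ≡ cut → ¬ Covered graph s M
      cut-uncovered s ps s-covered = <⇒≱ (s≤s 3≤|U|)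
        (unique-⊆⇒length≤ (All.tabulate (λ { z∈U refl → U-uncovered z∈U s-covered }) ∷ U-unique)
          λ { (here refl) → complete (members-enumeration cut) ps
            ; (there z∈U) → complete (members-enumeration cut) (All.lookup U-in-cut z∈U) })

      left-covered : ∀ {x} → part x ≡ left → Covered graph x M
      left-covered {x} px with x ∈ˡ? endpoints graph M
      ... | yes covered    = covered
      ... | no uncovered-x = contradiction
        (trans (≡.sym px) (All.lookup U-in-cut (∈-filter⁺ (uncovered? M) (∈-allFin x) uncovered-x))) λ ()

      covered-lefts : Enumeration (λ x → part x ≡ left) (filter (in-block? left) (endpoints graph M))
      covered-lefts = record
        { unique   = Uniqueₚ.filter⁺ (in-block? left) (proj₂ (proj₁ M-maximal))
        ; sound    = all-filter (in-block? left) (endpoints graph M)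
        ; complete = λ px → ∈-filter⁺ (in-block? left) (left-covered px) px
        }

      m-even : ∃ λ k → suc (2 * a) ≡ 2 * k
      m-even with k , even ← block-endpoints-even left (proj₁ M-maximal) cut-uncovered =
        k , trans (≡.sym (trans (enumeration-length covered-lefts (members-enumeration left))
                                (length-members leftV)))
                  even

    uncovered-<3 : length U < 3
    uncovered-<3 = ≰⇒> λ 3≤|U| → let k , m≡2k = m-even 3≤|U| in even≢odd k a (≡.sym m≡2k)

    half-≤ : half ≤ length M
    half-≤ = 2*m≤1+2*n⇒m≤n (s≤s⁻¹ (begin
      suc (2 * half)                              ≤⟨ covered-or-uncovered M ⟩
      length (endpoints graph M) + length U       ≤⟨ +-monoʳ-≤ (length (endpoints graph M)) (s≤s⁻¹ uncovered-<3) ⟩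
      length (endpoints graph M) + 2              ≡⟨ +-comm (length (endpoints graph M)) 2 ⟩
      2 + length (endpoints graph M)              ≡⟨ cong (2 +_) (length-endpoints graph M) ⟩
      2 + 2 * length M                            ∎))
      where open ≤-Reasoning

  equimatchable : Equimatchable graph
  equimatchable M M-maximal =
    proj₁ M-maximal , λ M′ M′-matching → ≤-trans (matching-≤ M′-matching) (MaximalMatching.half-≤ M-maximal)

proposition21 : ∀ (m n : ℕ) → 0 < m → 0 < n → Odd m → Odd n → 4 ≤ m + n →
    ∃ λ (v : ℕ) → ∃ λ (G : Graph v) →
      KConnected G 3 × Equimatchable G × FactorCritical G ×
      IndependenceNumber G 3 ×
      ∃ λ (S : Subset v) → ∃ λ (A : Subset v) → ∃ λ (B : Subset v) →
        ∣ S ∣ ≡ 3 × TwoComponentsAfter G S A B × ∣ A ∣ ≡ m × ∣ B ∣ ≡ n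
proposition21 _ _ _ _ (a , refl) (b , refl) large =
  v , graph , three-connected large , equimatchable , factor-critical large , independence-number ,
  block cut , block left , block right ,
  ∣block∣≡length (members-enumeration cut) , separation ,
  trans (∣block∣≡length (members-enumeration left)) (length-members leftV) ,
  trans (∣block∣≡length (members-enumeration right)) (length-members rightV)
  where open OddBlocks a b
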